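{- If $q\ge 16$ and $q$ is even, then $\operatorname{achr}(K_6\square K_q)\ge 2q+4$.
   Context: For a finite simple graph $G$, $\operatorname{achr}(G)$ (the achromatic number) is the maximum number of colours in a proper vertex colouring of $G$ that is complete, i.e. every pair of distinct colours appears on the two ends of some edge. $K_6\square K_q$ is the Cartesian product of the complete graphs $K_6$ and $K_q$ (vertex set $[1,6]\times[1,q]$, two vertices adjacent iff they agree in exactly one coordinate). -}

module Defs where

open import Data.Nat using (ℕ; _≤_)
open import Data.Fin using (Fin)
open import Data.Product using (Σ; _×_; _,_; ∃; ∃-syntax)
open import Relation.Binary.PropositionalEquality using (_≡_; _≢_)
open import Relation.Nullary using (¬_)
open import Data.Sum using (_⊎_; inj₁; inj₂)
open import Relation.Binary.PropositionalEquality using (refl) renaming (sym to ≡-sym)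

record Graph (V : Set) : Set₁ where
  field
    Adj   : V → V → Set
    irrefl : ∀ x → ¬ Adj x x
    sym   : ∀ {x y} → Adj x y → Adj y x
open Graph public

record IsColouring {V : Set} (G : Graph V) (k : ℕ) (c : V → Fin k) : Set where
  field
    surjective : ∀ (i : Fin k) → ∃[ v ] c v ≡ i
    proper     : ∀ {x y} → Adj G x y → c x ≢ c y

record IsCompleteColouring {V : Set} (G : Graph V) (k : ℕ) (c : V → Fin k) : Set where
  field
    colouring : IsColouring G k c
    complete  : ∀ (i j : Fin k) → i ≢ j →
                ∃[ x ] ∃[ y ] (Adj G x y × c x ≡ i × c y ≡ j)

-- achr G ≥ m : the maximum number of colours of a complete proper colouring is
-- at least m, i.e. some complete proper colouring uses k ≥ m colours.
AchrAtLeast : {V : Set} → Graph V → ℕ → Set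
AchrAtLeast {V} G m = ∃[ k ] (m ≤ k × Σ (V → Fin k) (IsCompleteColouring G k))

-- Cartesian product K_p □ K_q on Fin p × Fin q: adjacent iff they agree in
-- exactly one coordinate.
KK-Adj : (p q : ℕ) → Fin p × Fin q → Fin p × Fin q → Set
KK-Adj p q (a , b) (a' , b') = (a ≡ a' × b ≢ b') ⊎ (a ≢ a' × b ≡ b')

KK-irrefl : (p q : ℕ) → ∀ x → ¬ KK-Adj p q x x
KK-irrefl p q (a , b) (inj₁ (_ , ne)) = ne refl
KK-irrefl p q (a , b) (inj₂ (ne , _)) = ne refl

KK-sym : (p q : ℕ) → ∀ {x y} → KK-Adj p q x y → KK-Adj p q y x
KK-sym p q (inj₁ (e , ne)) = inj₁ (≡-sym e , λ z → ne (≡-sym z))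
KK-sym p q (inj₂ (ne , e)) = inj₂ ((λ z → ne (≡-sym z)) , ≡-sym e)

KK : (p q : ℕ) → Graph (Fin p × Fin q)
KK p q = record { Adj = KK-Adj p q ; irrefl = KK-irrefl p q ; sym = KK-sym p q }

-- Write the colouring of K₆ □ K_q as a 6 × q array.  It is a complete proper colouring
-- as soon as no colour repeats in a row or a column and any two colours share a row or
-- a column.  For q = 4 + 2m we glue two arrays side by side.  The first is a fixed 6 × 4
-- gadget with 12 colours.  In the second, the rows are the six edges of K₄ on four colour
-- types, row r holds the two types of its edge, and column (u , h) of row r carries the
-- colour (u or σ u , type), for a fixed-point-free permutation σ of Fin m; these are 4m
-- colours.  Two types always lie on a common edge, and each gadget colour occupies the
-- two rows of a perfect matching of K₄, hence meets every type.  That makes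
-- 12 + 4m = 2q + 4 colours.
module Submission where

open import Defs
open import Data.Bool using (Bool; true; false; if_then_else_)
open import Data.Bool.Properties using () renaming (_≟_ to _≟ᵇ_)
open import Data.Fin using (Fin; zero; suc; toℕ; _↑ˡ_; _↑ʳ_; #_)
open import Data.Fin.Permutation using (Permutation′; cast-id)
open import Data.Fin.Properties
  using (+↔⊎; *↔×; toℕ-cast; toℕ-↑ˡ; all?; any?) renaming (_≟_ to _≟ᶠ_)
open import Data.Nat using (ℕ; suc; _≤_; _+_; _*_; s≤s)
open import Data.Nat.Divisibility using (_∣_; divides)
open import Data.Nat.Properties
  using (≤-reflexive; ≤-trans; +-comm; 1+n≢n; 1+n≢0; m+n≤o⇒n≤o; *-cancelʳ-≤)
open import Data.Nat.Tactic.RingSolver using (solve-∀)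
open import Data.Product using (_×_; _,_; ∃-syntax)
open import Data.Product.Properties using (,-injective) renaming (≡-dec to ×-≡-dec)
open import Data.Sum using (_⊎_; inj₁; inj₂) renaming (map to ⊎-map)
open import Data.Sum.Algebra using (⊎-comm)
open import Data.Sum.Function.Propositional using (_⊎-↔_)
open import Data.Sum.Properties using (inj₁-injective; inj₂-injective)
open import Data.Vec using (Vec; []; _∷_; lookup)
open import Function using (_∘_; Injective)
open import Function.Bundles using (_↔_; Inverse; Injection)
open import Function.Properties.Inverse using (↔-refl; ↔-sym; ↔-trans; ↔⇒↣)
open import Relation.Binary.Definitions using (DecidableEquality)
open import Relation.Binary.PropositionalEquality
  using (_≡_; _≢_; refl; trans; cong; cong₂) renaming (sym to ≡-sym)
open import Relation.Nullary using (contradiction)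
open import Relation.Nullary.Decidable using (Dec; map′; from-yes; _×-dec_; _⊎-dec_; _→-dec_)

open Inverse using (to; from; strictlyInverseˡ; strictlyInverseʳ)

private
  variable
    p q k : ℕ
    C C₁ C₂ H K K₁ K₂ T : Set

to-injective : (e : C ↔ K) → Injective _≡_ _≡_ (to e)
to-injective e = Injection.injective (↔⇒↣ e)

from-injective : (e : C ↔ K) → Injective _≡_ _≡_ (from e)
from-injective e = to-injective (↔-sym e)

SharesRow : (Fin p → C₁ → K₁) → (Fin p → C₂ → K₂) → K₁ → K₂ → Set
SharesRow f g i j = ∃[ r ] ∃[ x ] ∃[ y ] (f r x ≡ i × g r y ≡ j)

SharesColumn : (Fin p → C → K) → K → K → Set
SharesColumn f i j = ∃[ x ] ∃[ r ] ∃[ s ] (f r x ≡ i × f s x ≡ j)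

SharesLine : (Fin p → C → K) → K → K → Set
SharesLine f i j = SharesRow f f i j ⊎ SharesColumn f i j

record IsCompleteArray (f : Fin p → C → K) : Set where
  field
    row-injective    : ∀ r → Injective _≡_ _≡_ (f r)
    column-injective : ∀ x → Injective _≡_ _≡_ (λ r → f r x)
    sharesLine       : ∀ i j → SharesLine f i j

achr-≥-array : {f : Fin p → C → K} → IsCompleteArray f →
               C ↔ Fin q → K ↔ Fin k → AchrAtLeast (KK p q) k
achr-≥-array {p = p} {q = q} {k = k} {f = f} A e d =
  k , ≤-reflexive refl , colour , record
    { colouring = record { surjective = surjective ; proper = proper }
    ; complete  = complete
    }
  where
  open IsCompleteArray A

  colour : Fin p × Fin q → Fin k
  colour (r , b) = to d (f r (from e b))

  colour-at : ∀ {r x i} → f r x ≡ from d i → colour (r , to e x) ≡ i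
  colour-at {r} {x} {i} fx≡i = trans (cong (to d ∘ f r) (strictlyInverseʳ e x))
                                     (trans (cong (to d) fx≡i) (strictlyInverseˡ d i))

  surjective : ∀ i → ∃[ v ] colour v ≡ i
  surjective i with sharesLine (from d i) (from d i)
  ... | inj₁ (r , x , _ , fx≡i , _) = (r , to e x) , colour-at fx≡i
  ... | inj₂ (x , r , _ , fx≡i , _) = (r , to e x) , colour-at fx≡i

  proper : ∀ {v w} → Adj (KK p q) v w → colour v ≢ colour w
  proper (inj₁ (refl , b≢b′)) =
    b≢b′ ∘ from-injective e ∘ row-injective _ ∘ to-injective d
  proper (inj₂ (a≢a′ , refl)) = a≢a′ ∘ column-injective _ ∘ to-injective d

  complete : ∀ i j → i ≢ j → ∃[ v ] ∃[ w ] (Adj (KK p q) v w × colour v ≡ i × colour w ≡ j)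
  complete i j i≢j with sharesLine (from d i) (from d j)
  ... | inj₁ (r , x , y , fx≡i , fy≡j) =
    (r , to e x) , (r , to e y) ,
    inj₁ (refl , λ ex≡ey → i≢j (from-injective d (trans (≡-sym fx≡i)
                    (trans (cong (f r) (to-injective e ex≡ey)) fy≡j)))) ,
    colour-at fx≡i , colour-at fy≡j
  ... | inj₂ (x , r , s , fr≡i , fs≡j) =
    (r , to e x) , (s , to e x) ,
    inj₂ ((λ r≡s → i≢j (from-injective d (trans (≡-sym fr≡i)
                    (trans (cong (λ t → f t x) r≡s) fs≡j)))) , refl) ,
    colour-at fr≡i , colour-at fs≡j

_⊕_ : (Fin p → C₁ → K₁) → (Fin p → C₂ → K₂) → Fin p → C₁ ⊎ C₂ → K₁ ⊎ K₂
(f ⊕ g) r = ⊎-map (f r) (g r)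

module _ {f : Fin p → C₁ → K₁} {g : Fin p → C₂ → K₂} where

  ⊕-sharesLineˡ : ∀ {i i′} → SharesLine f i i′ → SharesLine (f ⊕ g) (inj₁ i) (inj₁ i′)
  ⊕-sharesLineˡ (inj₁ (r , x , y , e , e′)) = inj₁ (r , inj₁ x , inj₁ y , cong inj₁ e , cong inj₁ e′)
  ⊕-sharesLineˡ (inj₂ (x , r , s , e , e′)) = inj₂ (inj₁ x , r , s , cong inj₁ e , cong inj₁ e′)

  ⊕-sharesLineʳ : ∀ {j j′} → SharesLine g j j′ → SharesLine (f ⊕ g) (inj₂ j) (inj₂ j′)
  ⊕-sharesLineʳ (inj₁ (r , x , y , e , e′)) = inj₁ (r , inj₂ x , inj₂ y , cong inj₂ e , cong inj₂ e′)
  ⊕-sharesLineʳ (inj₂ (x , r , s , e , e′)) = inj₂ (inj₂ x , r , s , cong inj₂ e , cong inj₂ e′)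

  ⊕-isCompleteArray : IsCompleteArray f → IsCompleteArray g → (∀ i j → SharesRow f g i j) →
                      IsCompleteArray (f ⊕ g)
  ⊕-isCompleteArray F G cross = record
    { row-injective    = row-injective
    ; column-injective = column-injective
    ; sharesLine       = sharesLine
    }
    where
    module F = IsCompleteArray F
    module G = IsCompleteArray G

    row-injective : ∀ r → Injective _≡_ _≡_ ((f ⊕ g) r)
    row-injective r {inj₁ x} {inj₁ y} e = cong inj₁ (F.row-injective r (inj₁-injective e))
    row-injective r {inj₂ x} {inj₂ y} e = cong inj₂ (G.row-injective r (inj₂-injective e))

    column-injective : ∀ x → Injective _≡_ _≡_ (λ r → (f ⊕ g) r x)
    column-injective (inj₁ x) = F.column-injective x ∘ inj₁-injective
    column-injective (inj₂ x) = G.column-injective x ∘ inj₂-injective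

    sharesLine : ∀ i j → SharesLine (f ⊕ g) i j
    sharesLine (inj₁ i) (inj₁ i′) = ⊕-sharesLineˡ (F.sharesLine i i′)
    sharesLine (inj₂ j) (inj₂ j′) = ⊕-sharesLineʳ (G.sharesLine j j′)
    sharesLine (inj₁ i) (inj₂ j) with cross i j
    ... | r , x , y , e , e′ = inj₁ (r , inj₁ x , inj₂ y , cong inj₁ e , cong inj₂ e′)
    sharesLine (inj₂ j) (inj₁ i) with cross i j
    ... | r , x , y , e , e′ = inj₁ (r , inj₂ y , inj₁ x , cong inj₂ e′ , cong inj₁ e)

rotation : ∀ {n} → Permutation′ (suc n)
rotation {n} = ↔-trans +↔⊎ (↔-trans (⊎-comm (Fin 1) (Fin n))
                 (↔-trans (↔-sym +↔⊎) (cast-id (+-comm n 1))))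

rotation-fixedPointFree : ∀ {n} (i : Fin (2 + n)) → to rotation i ≢ i
rotation-fixedPointFree {n} zero σi≡i =
  1+n≢0 (trans (≡-sym (toℕ-cast (+-comm (suc n) 1) (suc n ↑ʳ zero))) (cong toℕ σi≡i))
rotation-fixedPointFree {n} (suc i) σi≡i =
  1+n≢n (trans (cong toℕ (≡-sym σi≡i))
               (trans (toℕ-cast (+-comm (suc n) 1) (i ↑ˡ 1)) (toℕ-↑ˡ i 1)))

module Shifted {U : Set} (σ : U ↔ U) (σ-fixedPointFree : ∀ u → to σ u ≢ u) where

  shift : Bool → U → U
  shift b u = if b then to σ u else u

  unshift : Bool → U → U
  unshift b u = if b then from σ u else u

  shift-unshift : ∀ b u → shift b (unshift b u) ≡ u
  shift-unshift true  = strictlyInverseˡ σ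
  shift-unshift false u = refl

  shift-injective : ∀ b → Injective _≡_ _≡_ (shift b)
  shift-injective true  = to-injective σ
  shift-injective false = λ e → e

  shift-reflects : ∀ b b′ u → shift b u ≡ shift b′ u → b ≡ b′
  shift-reflects true  true  u _ = refl
  shift-reflects false false u _ = refl
  shift-reflects true  false u e = contradiction e (σ-fixedPointFree u)
  shift-reflects false true  u e = contradiction (≡-sym e) (σ-fixedPointFree u)

  shifted : (Fin p → H → T) → (Fin p → H → Bool) → Fin p → U × H → U × T
  shifted tag shf r (u , h) = shift (shf r h) u , tag r h

  module _ {tag : Fin p → H → T} {shf : Fin p → H → Bool} where

    shifted-at : ∀ {r h ty} t → tag r h ≡ ty → shifted tag shf r (unshift (shf r h) t , h) ≡ (t , ty)
    shifted-at {r} {h} t refl = cong (_, tag r h) (shift-unshift (shf r h) t)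

    sharesRow-shiftedʳ : ∀ {f : Fin p → C → K} {i ty} t →
                         SharesRow f tag i ty → SharesRow f (shifted tag shf) i (t , ty)
    sharesRow-shiftedʳ t (r , x , h , e , e′) = r , x , _ , e , shifted-at t e′

    shifted-isCompleteArray : (∀ r → Injective _≡_ _≡_ (tag r)) →
                              (∀ h → Injective _≡_ _≡_ (λ r → tag r h , shf r h)) →
                              (∀ ty ty′ → SharesRow tag tag ty ty′) →
                              IsCompleteArray (shifted tag shf)
    shifted-isCompleteArray tag-injective tagShift-injective tagsShareRow = record
      { row-injective    = row-injective
      ; column-injective = column-injective
      ; sharesLine       = λ (t , ty) (t′ , ty′) → inj₁ (sharesRow-shifted t t′ (tagsShareRow ty ty′))
      }
      where
      row-injective : ∀ r → Injective _≡_ _≡_ (shifted tag shf r)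
      row-injective r {u , h} {u′ , h′} e with ,-injective e
      ... | su≡su′ , th≡th′ with tag-injective r th≡th′
      ... | refl = cong (_, h) (shift-injective (shf r h) su≡su′)

      column-injective : ∀ x → Injective _≡_ _≡_ (λ r → shifted tag shf r x)
      column-injective (u , h) {r} {r′} e with ,-injective e
      ... | su≡su′ , tr≡tr′ =
        tagShift-injective h (cong₂ _,_ tr≡tr′ (shift-reflects (shf r h) (shf r′ h) u su≡su′))

      sharesRow-shifted : ∀ {ty ty′} t t′ → SharesRow tag tag ty ty′ →
                          SharesRow (shifted tag shf) (shifted tag shf) (t , ty) (t′ , ty′)
      sharesRow-shifted t t′ (r , h , h′ , e , e′) = r , _ , _ , shifted-at t e , shifted-at t′ e′

injective? : ∀ {n} → DecidableEquality K → (f : Fin n → K) → Dec (Injective _≡_ _≡_ f)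
injective? _≟_ f = map′ (λ inj → inj _ _) (λ inj _ _ → inj)
                        (all? λ x → all? λ y → (f x ≟ f y) →-dec (x ≟ᶠ y))

sharesRow? : ∀ {c c′} → DecidableEquality K₁ → DecidableEquality K₂ →
             (f : Fin p → Fin c → K₁) (g : Fin p → Fin c′ → K₂) → ∀ i j → Dec (SharesRow f g i j)
sharesRow? _≟₁_ _≟₂_ f g i j = any? λ r → any? λ x → any? λ y → (f r x ≟₁ i) ×-dec (g r y ≟₂ j)

sharesLine? : ∀ {c} → DecidableEquality K → (f : Fin p → Fin c → K) → ∀ i j → Dec (SharesLine f i j)
sharesLine? _≟_ f i j = sharesRow? _≟_ _≟_ f f i j ⊎-dec
                        (any? λ x → any? λ r → any? λ s → (f r x ≟ i) ×-dec (f s x ≟ j))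

-- Colours 0–3, 4–7 and 8–11 occupy the row pairs {0,1}, {2,5} and {3,4}, which are the
-- three perfect matchings of K₄ under the edge labelling of typeTable.
gadgetTable : Vec (Vec (Fin 12) 4) 6
gadgetTable = (# 0 ∷ # 1  ∷ # 2  ∷ # 3 ∷ []) ∷
              (# 1 ∷ # 0  ∷ # 3  ∷ # 2 ∷ []) ∷
              (# 4 ∷ # 6  ∷ # 5  ∷ # 7 ∷ []) ∷
              (# 8 ∷ # 10 ∷ # 11 ∷ # 9 ∷ []) ∷
              (# 9 ∷ # 11 ∷ # 10 ∷ # 8 ∷ []) ∷
              (# 5 ∷ # 7  ∷ # 4  ∷ # 6 ∷ []) ∷ []

typeTable : Vec (Vec (Fin 4) 2) 6
typeTable = (# 0 ∷ # 2 ∷ []) ∷ (# 1 ∷ # 3 ∷ []) ∷ (# 1 ∷ # 0 ∷ []) ∷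
            (# 3 ∷ # 0 ∷ []) ∷ (# 2 ∷ # 1 ∷ []) ∷ (# 2 ∷ # 3 ∷ []) ∷ []

shiftTable : Vec (Vec Bool 2) 6
shiftTable = (false ∷ false ∷ []) ∷ (false ∷ false ∷ []) ∷ (true ∷ false ∷ []) ∷
             (true  ∷ true  ∷ []) ∷ (true  ∷ false ∷ []) ∷ (false ∷ true ∷ []) ∷ []

gadget : Fin 6 → Fin 4 → Fin 12
gadget r x = lookup (lookup gadgetTable r) x

type : Fin 6 → Fin 2 → Fin 4
type r h = lookup (lookup typeTable r) h

isShifted : Fin 6 → Fin 2 → Bool
isShifted r h = lookup (lookup shiftTable r) h

gadget-isCompleteArray : IsCompleteArray gadget
gadget-isCompleteArray = record
  { row-injective    = from-yes (all? λ r → injective? _≟ᶠ_ (gadget r))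
  ; column-injective = from-yes (all? λ x → injective? _≟ᶠ_ (λ r → gadget r x))
  ; sharesLine       = from-yes (all? λ i → all? λ j → sharesLine? _≟ᶠ_ gadget i j)
  }

type-injective : ∀ r → Injective _≡_ _≡_ (type r)
type-injective = from-yes (all? λ r → injective? _≟ᶠ_ (type r))

typeShift-injective : ∀ h → Injective _≡_ _≡_ (λ r → type r h , isShifted r h)
typeShift-injective =
  from-yes (all? λ h → injective? (×-≡-dec _≟ᶠ_ _≟ᵇ_) (λ r → type r h , isShifted r h))

typesShareRow : ∀ ty ty′ → SharesRow type type ty ty′
typesShareRow = from-yes (all? λ ty → all? λ ty′ → sharesRow? _≟ᶠ_ _≟ᶠ_ type type ty ty′)

gadgetSharesRowWithTypes : ∀ i ty → SharesRow gadget type i ty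
gadgetSharesRowWithTypes = from-yes (all? λ i → all? λ ty → sharesRow? _≟ᶠ_ _≟ᶠ_ gadget type i ty)

achrAtLeast-weaken : ∀ {V} {G : Graph V} {j k} → j ≤ k → AchrAtLeast G k → AchrAtLeast G j
achrAtLeast-weaken j≤k (l , k≤l , c) = l , ≤-trans j≤k k≤l , c

achr-K₆□K[8+2n] : ∀ n → AchrAtLeast (KK 6 (8 + n * 2)) (2 * (8 + n * 2) + 4)
achr-K₆□K[8+2n] n =
  achrAtLeast-weaken (≤-reflexive (colourCount (2 + n)))
    (achr-≥-array (⊕-isCompleteArray gadget-isCompleteArray regular-isCompleteArray cross)
                  (↔-sym (↔-trans +↔⊎ (↔-refl ⊎-↔ *↔×)))
                  (↔-sym (↔-trans +↔⊎ (↔-refl ⊎-↔ *↔×))))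
  where
  open Shifted (rotation {suc n}) rotation-fixedPointFree

  regular-isCompleteArray : IsCompleteArray (shifted type isShifted)
  regular-isCompleteArray = shifted-isCompleteArray type-injective typeShift-injective typesShareRow

  cross : ∀ i j → SharesRow gadget (shifted type isShifted) i j
  cross i (t , ty) = sharesRow-shiftedʳ t (gadgetSharesRowWithTypes i ty)

  colourCount : ∀ m → 2 * (4 + m * 2) + 4 ≡ 12 + m * 4
  colourCount = solve-∀

achr-K₆□K-even : ∀ q → 8 ≤ q → 2 ∣ q → AchrAtLeast (KK 6 q) (2 * q + 4)
achr-K₆□K-even _ 8≤q (divides m refl) with *-cancelʳ-≤ 4 m 2 8≤q
... | s≤s (s≤s (s≤s (s≤s {n = n} _))) = achr-K₆□K[8+2n] n

proposition7 : (q : ℕ) → 16 ≤ q → 2 ∣ q → AchrAtLeast (KK 6 q) (2 * q + 4)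
proposition7 q 16≤q = achr-K₆□K-even q (m+n≤o⇒n≤o 8 16≤q)
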